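{- Let $n\ge4$ be an integer, $\mathrm{TH}_m=\binom{m+2}{3}$, and $\mathcal{TH}_n=\langle \mathrm{TH}_n,\mathrm{TH}_{n+1},\mathrm{TH}_{n+2},\mathrm{TH}_{n+3}\rangle$. Then $\mathcal{TH}_n$ is a free numerical semigroup with embedding dimension equal to four.
   Context: $\langle a_1,\ldots,a_k\rangle$ denotes the set of non-negative integer linear combinations of $a_1,\ldots,a_k$. A numerical semigroup is a submonoid of $(\mathbb N,+)$ with finite complement in $\mathbb N$; it has a unique minimal system of generators, whose cardinality is its embedding dimension. A sequence $(a_1,\ldots,a_k)$ of positive integers with $\gcd=1$ is telescopic if, with $d_i=\gcd\{a_1,\ldots,a_i\}$, each $a_i/d_i$ ($2\le i\le k$) is a non-negative integer combination of $a_1/d_{i-1},\ldots,a_{i-1}/d_{i-1}$. A numerical semigroup $S$ is free if $S=\langle a_1,\ldots,a_k\rangle$ for some telescopic sequence $(a_1,\ldots,a_k)$. -}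

module Defs where

open import Data.Nat using (ℕ; zero; suc; _+_; _*_; _≤_; _<_)
open import Data.Nat.GCD using (gcd)
open import Data.Nat.Combinatorics using (_C_)
open import Data.List using (List; []; _∷_; _++_; _∷ʳ_; length; foldr; zipWith)
open import Data.Nat.ListAction using (sum)
open import Data.List.Relation.Unary.All using (All)
open import Data.List.Relation.Unary.Unique.Propositional using (Unique)
open import Data.List.Membership.Propositional using (_∈_)
open import Data.List.Relation.Binary.Pointwise using (Pointwise)
open import Data.Product using (Σ; ∃; _×_; _,_)
open import Relation.Binary.PropositionalEquality using (_≡_; _≢_)
open import Relation.Nullary using (¬_)
open import Function.Bundles using (_⇔_)

TH : ℕ → ℕ
TH m = (m + 2) C 3

Subset : Set₁
Subset = ℕ → Set

gcdL : List ℕ → ℕ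
gcdL = foldr gcd 0

⟨_⟩ : List ℕ → Subset
⟨ gs ⟩ x = Σ (List ℕ) λ cs → length cs ≡ length gs × x ≡ sum (zipWith _*_ cs gs)

IsNumericalSemigroup : Subset → Set
IsNumericalSemigroup S =
  S 0 × (∀ x y → S x → S y → S (x + y)) × (∃ λ F → ∀ x → F ≤ x → S x)

-- Telescopic step for the prefix ps followed by a:
-- a / d_i ∈ ⟨ p_1 / d_{i-1}, …, p_{i-1} / d_{i-1} ⟩, with d_{i-1} = gcd ps,
-- d_i = gcd (ps ++ [a]); the exact quotients are written out explicitly.
TeleStep : List ℕ → ℕ → Set
TeleStep ps a =
  Σ ℕ λ q → q * gcdL (ps ∷ʳ a) ≡ a ×
    Σ (List ℕ) λ qs → Pointwise (λ q′ p → q′ * gcdL ps ≡ p) qs ps × ⟨ qs ⟩ q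

Telescopic : List ℕ → Set
Telescopic as =
  All (λ a → 0 < a) as × gcdL as ≡ 1 ×
  (∀ ps a rest → as ≡ ps ++ a ∷ rest → 1 ≤ length ps → TeleStep ps a)

IsFree : Subset → Set
IsFree S = Σ (List ℕ) λ as → Telescopic as × (∀ x → S x ⇔ ⟨ as ⟩ x)

IsFreeNumericalSemigroup : Subset → Set
IsFreeNumericalSemigroup S = IsNumericalSemigroup S × IsFree S

IsMinimalSystemOfGenerators : Subset → List ℕ → Set
IsMinimalSystemOfGenerators S gs =
  Unique gs ×
  (∀ x → (x ∈ gs) ⇔
     (S x × x ≢ 0 ×
      ¬ (Σ ℕ λ a → Σ ℕ λ b → S a × S b × a ≢ 0 × b ≢ 0 × a + b ≡ x)))

EmbeddingDimension : Subset → ℕ → Set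
EmbeddingDimension S e =
  Σ (List ℕ) λ gs → IsMinimalSystemOfGenerators S gs × length gs ≡ e

𝒯ℋ : ℕ → Subset
𝒯ℋ n = ⟨ TH n ∷ TH (n + 1) ∷ TH (n + 2) ∷ TH (n + 3) ∷ [] ⟩

-- The generators satisfy TH (n+3) + 3 TH (n+1) = 3 TH (n+2) + TH n + 1 (the third difference of
-- the cubic TH is 1), so 𝒯ℋ n contains two consecutive integers N, N + 1: hence the gcd of the
-- generators is 1 and every x ≥ N² lies in 𝒯ℋ n.
--
-- Freeness: write n = k + 6 j with 4 ≤ k ≤ 9. Since TH m = m (m+1) (m+2) / 6, each generator
-- factors into three linear polynomials in j, and so do the partial gcds d₂, d₃ of the sequence.
-- For k ≤ 5 the decreasing order, for k ≥ 6 the increasing order is telescopic, and all required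
-- divisibilities, coprimalities and memberships are polynomial identities in j.
--
-- Embedding dimension: the generators increase, and none lies in the semigroup generated by the
-- smaller ones; for n ≥ 11 because TH (n+3) < 2 TH n, for 4 ≤ n ≤ 10 by evaluation.
module Submission where

open import Defs
open import Data.Nat using (ℕ; zero; suc; _+_; _*_; _∸_; _≤_; _<_; z≤n; s≤s; _≟_; _≤?_; _<?_)
open import Data.Nat.Properties
open import Data.Nat.Combinatorics using (_C_; nCk+nC[k+1]≡[n+1]C[k+1]; nC1≡n)
open import Data.Nat.Divisibility
  using (_∣_; divides; _∣0; ∣-trans; ∣m∣n⇒∣m+n; ∣n⇒∣m*n; ∣m+n∣m⇒∣n; ∣1⇒≡1)
open import Data.Nat.DivMod using (_/_; _%_; m%n<n; m*n/n≡m; /-monoˡ-≤; m≡m%n+[m/n]*n)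
open import Data.Nat.GCD using (gcd; gcd[m,n]∣m; gcd[m,n]∣n; gcd-identityʳ; c*gcd[m,n]≡gcd[cm,cn])
open import Data.Nat.Tactic.RingSolver using (solve-∀)
open import Data.List using (List; []; _∷_; _++_; _∷ʳ_; length; reverse)
open import Data.List.Properties using (∷ʳ-++)
open import Data.List.Membership.Propositional using (_∈_)
open import Data.List.Relation.Unary.All using (All; []; _∷_; lookup; tabulate)
import Data.List.Relation.Unary.All as All
open import Data.List.Relation.Unary.AllPairs using (AllPairs; []; _∷_)
import Data.List.Relation.Unary.AllPairs as AllPairs
open import Data.List.Relation.Unary.Any using (here; there)
import Data.List.Relation.Unary.Any.Properties as Any
open import Data.List.Relation.Unary.Linked using (Linked; [-]; _∷_)
open import Data.List.Relation.Unary.Linked.Properties using (Linked⇒All; Linked⇒AllPairs)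
open import Data.List.Relation.Unary.Unique.Propositional using (Unique)
open import Data.List.Relation.Binary.Pointwise using (Pointwise; []; _∷_; Pointwise-≡⇒≡)
open import Data.Product using (Σ; ∃; ∃₂; _×_; _,_)
open import Data.Sum using (inj₁; inj₂)
open import Data.Unit using (⊤; tt)
open import Data.Empty using (⊥-elim)
open import Function using (id; _∘_)
open import Function.Bundles using (mk⇔)
open import Relation.Nullary using (¬_; Dec; yes; no; ¬?)
open import Relation.Nullary.Decidable using (map′; _×-dec_; _→-dec_; from-yes)
open import Relation.Unary using (Decidable)
open import Relation.Binary.PropositionalEquality

-- Semigroups generated by a list

⟨⟩-[]⁻ : ∀ {x} → ⟨ [] ⟩ x → x ≡ 0
⟨⟩-[]⁻ ([] , _ , x≡0) = x≡0

⟨⟩-∷⁺ : ∀ {g gs y} c → ⟨ gs ⟩ y → ⟨ g ∷ gs ⟩ (c * g + y)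
⟨⟩-∷⁺ c (cs , |cs|≡|gs| , refl) = c ∷ cs , cong suc |cs|≡|gs| , refl

⟨⟩-∷⁻ : ∀ {g gs x} → ⟨ g ∷ gs ⟩ x → ∃₂ λ c y → ⟨ gs ⟩ y × x ≡ c * g + y
⟨⟩-∷⁻ (c ∷ cs , |cs|≡|gs| , refl) = c , _ , (cs , suc-injective |cs|≡|gs| , refl) , refl

⟨⟩-0 : ∀ gs → ⟨ gs ⟩ 0
⟨⟩-0 []       = [] , refl , refl
⟨⟩-0 (g ∷ gs) = ⟨⟩-∷⁺ 0 (⟨⟩-0 gs)

⟨⟩-+ : ∀ {gs x y} → ⟨ gs ⟩ x → ⟨ gs ⟩ y → ⟨ gs ⟩ (x + y)
⟨⟩-+ {[]} x∈ y∈ rewrite ⟨⟩-[]⁻ x∈ | ⟨⟩-[]⁻ y∈ = ⟨⟩-0 []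
⟨⟩-+ {g ∷ gs} x∈ y∈ with ⟨⟩-∷⁻ x∈ | ⟨⟩-∷⁻ y∈
... | c , u , u∈ , refl | d , v , v∈ , refl =
  subst ⟨ g ∷ gs ⟩ (regroup c d g u v) (⟨⟩-∷⁺ (c + d) (⟨⟩-+ u∈ v∈))
  where
  regroup : ∀ c d g u v → (c + d) * g + (u + v) ≡ (c * g + u) + (d * g + v)
  regroup = solve-∀

⟨⟩-* : ∀ {gs x} c → ⟨ gs ⟩ x → ⟨ gs ⟩ (c * x)
⟨⟩-* {gs} zero    x∈ = ⟨⟩-0 gs
⟨⟩-*      (suc c) x∈ = ⟨⟩-+ x∈ (⟨⟩-* c x∈)

⟨⟩-∈ : ∀ {g gs} → g ∈ gs → ⟨ gs ⟩ g
⟨⟩-∈ {g} {_ ∷ gs} (here refl) =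
  subst ⟨ g ∷ gs ⟩ (trans (+-identityʳ (1 * g)) (*-identityˡ g)) (⟨⟩-∷⁺ {g} 1 (⟨⟩-0 gs))
⟨⟩-∈ (there g∈) = ⟨⟩-∷⁺ 0 (⟨⟩-∈ g∈)

⟨⟩-⊆ : ∀ {gs hs x} → All ⟨ hs ⟩ gs → ⟨ gs ⟩ x → ⟨ hs ⟩ x
⟨⟩-⊆ {[]} {hs} [] x∈ rewrite ⟨⟩-[]⁻ x∈ = ⟨⟩-0 hs
⟨⟩-⊆ {g ∷ gs} (g∈ ∷ gs⊆) x∈ with ⟨⟩-∷⁻ x∈
... | c , y , y∈ , refl = ⟨⟩-+ (⟨⟩-* c g∈) (⟨⟩-⊆ gs⊆ y∈)

⟨⟩-reverse⁺ : ∀ {gs x} → ⟨ gs ⟩ x → ⟨ reverse gs ⟩ x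
⟨⟩-reverse⁺ = ⟨⟩-⊆ (tabulate (⟨⟩-∈ ∘ Any.reverse⁺))

⟨⟩-reverse⁻ : ∀ {gs x} → ⟨ reverse gs ⟩ x → ⟨ gs ⟩ x
⟨⟩-reverse⁻ = ⟨⟩-⊆ (tabulate (⟨⟩-∈ ∘ Any.reverse⁻))

⟨⟩-∣ : ∀ {d gs x} → All (d ∣_) gs → ⟨ gs ⟩ x → d ∣ x
⟨⟩-∣ {d} [] x∈ rewrite ⟨⟩-[]⁻ x∈ = d ∣0
⟨⟩-∣ (d∣g ∷ d∣gs) x∈ with ⟨⟩-∷⁻ x∈
... | c , y , y∈ , refl = ∣m∣n⇒∣m+n (∣n⇒∣m*n c d∣g) (⟨⟩-∣ d∣gs y∈)

⟨⟩-split : ∀ {gs x} → ⟨ gs ⟩ x → x ≢ 0 → ∃₂ λ g r → g ∈ gs × ⟨ gs ⟩ r × x ≡ g + r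
⟨⟩-split {[]} x∈ x≢0 = ⊥-elim (x≢0 (⟨⟩-[]⁻ x∈))
⟨⟩-split {g ∷ gs} x∈ x≢0 with ⟨⟩-∷⁻ x∈
... | suc c , y , y∈ , refl = g , c * g + y , here refl , ⟨⟩-∷⁺ c y∈ , +-assoc g (c * g) y
... | zero  , y , y∈ , refl with ⟨⟩-split y∈ x≢0
...   | h , r , h∈ , r∈ , refl = h , r , there h∈ , ⟨⟩-∷⁺ 0 r∈ , refl

⟨⟩-≥ : ∀ {m gs x} → All (m ≤_) gs → ⟨ gs ⟩ x → x ≢ 0 → m ≤ x
⟨⟩-≥ m≤gs x∈ x≢0 with ⟨⟩-split x∈ x≢0
... | g , r , g∈ , _ , refl = ≤-trans (lookup m≤gs g∈) (m≤m+n g r)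

⟨⟩-++⁻ˡ : ∀ ls {hs x} → ⟨ ls ++ hs ⟩ x → All (x <_) hs → ⟨ ls ⟩ x
⟨⟩-++⁻ˡ [] {x = x} x∈ x<hs with x ≟ 0
... | yes refl = ⟨⟩-0 []
... | no x≢0 with ⟨⟩-split x∈ x≢0
...   | h , r , h∈ , _ , refl = ⊥-elim (m+n≮m h r (lookup x<hs h∈))
⟨⟩-++⁻ˡ (l ∷ ls) x∈ x<hs with ⟨⟩-∷⁻ x∈
... | c , y , y∈ , refl =
  ⟨⟩-∷⁺ c (⟨⟩-++⁻ˡ ls y∈ (All.map (≤-<-trans (m≤n+m y (c * l))) x<hs))

⟨⟩-gap : ∀ {m ls g} → All (m ≤_) ls → All (_< g) ls → 0 < g → g < m + m → ¬ ⟨ ls ⟩ g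
⟨⟩-gap m≤ls ls<g 0<g g<2m g∈ with ⟨⟩-split g∈ (>⇒≢ 0<g)
... | l , r , l∈ , r∈ , refl with r ≟ 0
...   | yes refl = <-irrefl (sym (+-identityʳ l)) (lookup ls<g l∈)
...   | no r≢0   = <⇒≱ g<2m (+-mono-≤ (lookup m≤ls l∈) (⟨⟩-≥ m≤ls r∈ r≢0))

⟨⟩-cofinite : ∀ {gs N} → ⟨ gs ⟩ N → ⟨ gs ⟩ (suc N) → ∀ x → N * N ≤ x → ⟨ gs ⟩ x
⟨⟩-cofinite {gs} {zero} _ 1∈ x _ = subst ⟨ gs ⟩ (*-identityʳ x) (⟨⟩-* x 1∈)
⟨⟩-cofinite {gs} {N@(suc _)} N∈ N+1∈ x N*N≤x =
  subst ⟨ gs ⟩ x≡ (⟨⟩-+ (⟨⟩-* (q ∸ r) N∈) (⟨⟩-* r N+1∈))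
  where
  open ≡-Reasoning
  r = x % N
  q = x / N
  r≤q : r ≤ q
  r≤q = ≤-trans (<⇒≤ (m%n<n x N)) (subst (_≤ q) (m*n/n≡m N N) (/-monoˡ-≤ N N*N≤x))
  regroup : ∀ t r N → t * N + r * suc N ≡ r + (t + r) * N
  regroup = solve-∀
  x≡ : (q ∸ r) * N + r * suc N ≡ x
  x≡ = begin
    (q ∸ r) * N + r * suc N ≡⟨ regroup (q ∸ r) r N ⟩
    r + (q ∸ r + r) * N     ≡⟨ cong (λ k → r + k * N) (m∸n+n≡m r≤q) ⟩
    r + q * N               ≡⟨ m≡m%n+[m/n]*n x N ⟨
    x                       ∎

⟨⟩-∷-bounded : ∀ {g gs x} → ⟨ g ∷ gs ⟩ x →
  ∃ λ c → c < suc x × (c * g ≤ x × ⟨ gs ⟩ (x ∸ c * g))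
⟨⟩-∷-bounded {zero} x∈ with ⟨⟩-∷⁻ x∈
... | c , y , y∈ , refl rewrite *-zeroʳ c = 0 , s≤s z≤n , z≤n , y∈
⟨⟩-∷-bounded {g@(suc _)} x∈ with ⟨⟩-∷⁻ x∈
... | c , y , y∈ , refl =
  c , s≤s (≤-trans (m≤m*n c g) cg≤x) , cg≤x , subst ⟨ _ ⟩ (sym (m+n∸m≡n (c * g) y)) y∈
  where cg≤x = m≤m+n (c * g) y

⟨⟩-∷-bounded⁻ : ∀ {g gs x} → (∃ λ c → c < suc x × (c * g ≤ x × ⟨ gs ⟩ (x ∸ c * g))) →
  ⟨ g ∷ gs ⟩ x
⟨⟩-∷-bounded⁻ (c , _ , cg≤x , r∈) = subst ⟨ _ ⟩ (m+[n∸m]≡n cg≤x) (⟨⟩-∷⁺ c r∈)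

⟨⟩? : ∀ gs → Decidable ⟨ gs ⟩
⟨⟩? []       x = map′ (λ { refl → ⟨⟩-0 [] }) ⟨⟩-[]⁻ (x ≟ 0)
⟨⟩? (g ∷ gs) x = map′ ⟨⟩-∷-bounded⁻ ⟨⟩-∷-bounded
  (anyUpTo? (λ c → c * g ≤? x ×-dec ⟨⟩? gs (x ∸ c * g)) (suc x))

Decomposable : Subset → ℕ → Set
Decomposable S x = Σ ℕ λ a → Σ ℕ λ b → S a × S b × a ≢ 0 × b ≢ 0 × a + b ≡ x

indecomposable : ∀ ls {g hs} → ¬ ⟨ ls ⟩ g → All (g ≤_) hs → ¬ Decomposable ⟨ ls ++ g ∷ hs ⟩ g
indecomposable ls {g} g∉ g≤hs (a , b , a∈ , b∈ , a≢0 , b≢0 , refl) =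
  g∉ (⟨⟩-+ (⟨⟩-++⁻ˡ ls a∈ (below a<g)) (⟨⟩-++⁻ˡ ls b∈ (below b<g)))
  where
  a<g = m<m+n a (n≢0⇒n>0 b≢0)
  b<g = subst (b <_) (+-comm b a) (m<m+n b (n≢0⇒n>0 a≢0))
  below : ∀ {x} → x < g → All (x <_) (g ∷ _)
  below x<g = x<g ∷ All.map (<-≤-trans x<g) g≤hs

Independent : List ℕ → List ℕ → Set
Independent ls []       = ⊤
Independent ls (h ∷ hs) = ¬ ⟨ ls ⟩ h × Independent (ls ∷ʳ h) hs

independent? : ∀ ls hs → Dec (Independent ls hs)
independent? ls []       = yes tt
independent? ls (h ∷ hs) = ¬? (⟨⟩? ls h) ×-dec independent? (ls ∷ʳ h) hs

independent⇒indecomposable : ∀ ls {hs} → AllPairs _<_ hs → Independent ls hs →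
  ∀ {g} → g ∈ hs → ¬ Decomposable ⟨ ls ++ hs ⟩ g
independent⇒indecomposable ls (h<hs ∷ _) (h∉ , _) (here refl) =
  indecomposable ls h∉ (All.map <⇒≤ h<hs)
independent⇒indecomposable ls {h ∷ hs} (_ ∷ increasing) (_ , independent) (there g∈) =
  subst (λ gs → ¬ Decomposable ⟨ gs ⟩ _) (∷ʳ-++ ls h hs)
    (independent⇒indecomposable (ls ∷ʳ h) increasing independent g∈)

minimal-generators : ∀ {gs} → All (0 <_) gs → Unique gs →
  (∀ {g} → g ∈ gs → ¬ Decomposable ⟨ gs ⟩ g) → IsMinimalSystemOfGenerators ⟨ gs ⟩ gs
minimal-generators {gs} gs>0 unique indecomposable = unique , λ _ → mk⇔ generator irreducible⇒∈
  where
  nonzero : ∀ {g} → g ∈ gs → g ≢ 0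
  nonzero g∈ = >⇒≢ (lookup gs>0 g∈)
  generator : ∀ {g} → g ∈ gs → ⟨ gs ⟩ g × g ≢ 0 × ¬ Decomposable ⟨ gs ⟩ g
  generator g∈ = ⟨⟩-∈ g∈ , nonzero g∈ , indecomposable g∈
  irreducible⇒∈ : ∀ {x} → ⟨ gs ⟩ x × x ≢ 0 × ¬ Decomposable ⟨ gs ⟩ x → x ∈ gs
  irreducible⇒∈ (x∈ , x≢0 , irreducible) with ⟨⟩-split x∈ x≢0
  ... | g , r , g∈ , r∈ , refl with r ≟ 0
  ...   | yes refl = subst (_∈ gs) (sym (+-identityʳ g)) g∈
  ...   | no r≢0   = ⊥-elim (irreducible (g , r , ⟨⟩-∈ g∈ , r∈ , nonzero g∈ , r≢0 , refl))

gcdL-∣ : ∀ gs → All (gcdL gs ∣_) gs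
gcdL-∣ []       = []
gcdL-∣ (g ∷ gs) = gcd[m,n]∣m g _ ∷ All.map (∣-trans (gcd[m,n]∣n g _)) (gcdL-∣ gs)

gcdL≡1 : ∀ {gs u} → ⟨ gs ⟩ u → ⟨ gs ⟩ (suc u) → gcdL gs ≡ 1
gcdL≡1 {gs} {u} u∈ u+1∈ =
  ∣1⇒≡1 (∣m+n∣m⇒∣n (⟨⟩-∣ (gcdL-∣ gs) (subst ⟨ gs ⟩ (+-comm 1 u) u+1∈)) (⟨⟩-∣ (gcdL-∣ gs) u∈))

gcdL-cofactors : ∀ {d ys xs} → Pointwise (λ y x → y * d ≡ x) ys xs → gcdL xs ≡ gcdL ys * d
gcdL-cofactors []                                    = refl
gcdL-cofactors {d} {y ∷ ys} {_ ∷ xs} (refl ∷ ys≈xs) = begin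
  gcd (y * d) (gcdL xs)     ≡⟨ cong (gcd (y * d)) (gcdL-cofactors ys≈xs) ⟩
  gcd (y * d) (gcdL ys * d) ≡⟨ cong₂ gcd (*-comm y d) (*-comm (gcdL ys) d) ⟩
  gcd (d * y) (d * gcdL ys) ≡⟨ c*gcd[m,n]≡gcd[cm,cn] d y (gcdL ys) ⟨
  d * gcd y (gcdL ys)       ≡⟨ *-comm d _ ⟩
  gcd y (gcdL ys) * d       ∎
  where open ≡-Reasoning

gcdL-coprimeCofactors : ∀ {d ys xs} → Pointwise (λ y x → y * d ≡ x) ys xs → gcdL ys ≡ 1 →
  gcdL xs ≡ d
gcdL-coprimeCofactors {d} ys≈xs gcd≡1 =
  trans (gcdL-cofactors ys≈xs) (trans (cong (_* d) gcd≡1) (*-identityˡ d))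

-- Telescopic sequences of length four

teleStep-singleton : ∀ a₁ a₂ → TeleStep (a₁ ∷ []) a₂
teleStep-singleton a₁ a₂ with gcdL-∣ (a₁ ∷ a₂ ∷ [])
... | _ ∷ divides q a₂≡q*d ∷ [] =
  q , sym a₂≡q*d , 1 ∷ [] , trans (*-identityˡ _) (gcd-identityʳ a₁) ∷ [] ,
  subst ⟨ 1 ∷ [] ⟩ (*-identityʳ q) (⟨⟩-* q (⟨⟩-∈ (here refl)))

teleStep : ∀ {ps a d e ys q} → gcdL ps ≡ d → gcdL (ps ∷ʳ a) ≡ e →
  Pointwise (λ y p → y * d ≡ p) ys ps → q * e ≡ a → ⟨ ys ⟩ q → TeleStep ps a
teleStep refl refl ys≈ps q*e≡a q∈ = _ , q*e≡a , _ , ys≈ps , q∈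

⟨⟩-combination₂ : ∀ {g₁ g₂} c₁ c₂ → ⟨ g₁ ∷ g₂ ∷ [] ⟩ (c₁ * g₁ + c₂ * g₂)
⟨⟩-combination₂ c₁ c₂ = ⟨⟩-+ (⟨⟩-* c₁ (⟨⟩-∈ (here refl))) (⟨⟩-* c₂ (⟨⟩-∈ (there (here refl))))

⟨⟩-combination₃ : ∀ {g₁ g₂ g₃} c₁ c₂ c₃ → ⟨ g₁ ∷ g₂ ∷ g₃ ∷ [] ⟩ (c₁ * g₁ + c₂ * g₂ + c₃ * g₃)
⟨⟩-combination₃ c₁ c₂ c₃ =
  ⟨⟩-+ (⟨⟩-+ (⟨⟩-* c₁ (⟨⟩-∈ (here refl))) (⟨⟩-* c₂ (⟨⟩-∈ (there (here refl)))))
       (⟨⟩-* c₃ (⟨⟩-∈ (there (there (here refl)))))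

-- The cofactors y and z
-- give d₂ = gcd (a₁, a₂) and d₃ = gcd (a₁, a₂, a₃), their coprimality being witnessed by Bézout
-- identities with non-negative coefficients s, t and u, v; p and q express the memberships
-- a₃ / d₃ = z₃ ∈ ⟨ y₁, y₂ ⟩ and a₄ ∈ ⟨ z₁, z₂, z₃ ⟩. Quantifying over j makes every field a
-- polynomial identity, proved by one call of the ring solver.
record Telescopic₄Certificate (a₁ a₂ a₃ a₄ : ℕ → ℕ) : Set where
  field
    d₂ y₁ y₂ : ℕ → ℕ
    y₁*d₂≡a₁ : ∀ j → y₁ j * d₂ j ≡ a₁ j
    y₂*d₂≡a₂ : ∀ j → y₂ j * d₂ j ≡ a₂ j
    s₁ s₂ t₁ t₂ : ℕ → ℕ
    y-bézout : ∀ j → s₁ j * y₁ j + s₂ j * y₂ j ≡ suc (t₁ j * y₁ j + t₂ j * y₂ j)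
    d₃ z₁ z₂ z₃ : ℕ → ℕ
    z₁*d₃≡a₁ : ∀ j → z₁ j * d₃ j ≡ a₁ j
    z₂*d₃≡a₂ : ∀ j → z₂ j * d₃ j ≡ a₂ j
    z₃*d₃≡a₃ : ∀ j → z₃ j * d₃ j ≡ a₃ j
    u₁ u₂ u₃ v₁ v₂ v₃ : ℕ → ℕ
    z-bézout : ∀ j → u₁ j * z₁ j + u₂ j * z₂ j + u₃ j * z₃ j
                     ≡ suc (v₁ j * z₁ j + v₂ j * z₂ j + v₃ j * z₃ j)
    p₁ p₂ : ℕ → ℕ
    z₃≡ : ∀ j → z₃ j ≡ p₁ j * y₁ j + p₂ j * y₂ j
    q₁ q₂ q₃ : ℕ → ℕ
    a₄≡ : ∀ j → a₄ j ≡ q₁ j * z₁ j + q₂ j * z₂ j + q₃ j * z₃ j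

telescopic₄ : ∀ {a₁ a₂ a₃ a₄} → Telescopic₄Certificate a₁ a₂ a₃ a₄ →
  ∀ {as} j → as ≡ a₁ j ∷ a₂ j ∷ a₃ j ∷ a₄ j ∷ [] → All (0 <_) as → gcdL as ≡ 1 → Telescopic as
telescopic₄ {a₁} {a₂} {a₃} {a₄} certificate j refl positive gcd≡1 = positive , gcd≡1 , step
  where
  open Telescopic₄Certificate certificate
  ys≈ : Pointwise (λ y a → y * d₂ j ≡ a) (y₁ j ∷ y₂ j ∷ []) (a₁ j ∷ a₂ j ∷ [])
  ys≈ = y₁*d₂≡a₁ j ∷ y₂*d₂≡a₂ j ∷ []
  zs≈ : Pointwise (λ z a → z * d₃ j ≡ a) (z₁ j ∷ z₂ j ∷ z₃ j ∷ []) (a₁ j ∷ a₂ j ∷ a₃ j ∷ [])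
  zs≈ = z₁*d₃≡a₁ j ∷ z₂*d₃≡a₂ j ∷ z₃*d₃≡a₃ j ∷ []
  gcdL-ys≡1 : gcdL (y₁ j ∷ y₂ j ∷ []) ≡ 1
  gcdL-ys≡1 = gcdL≡1 (⟨⟩-combination₂ (t₁ j) (t₂ j))
    (subst ⟨ _ ⟩ (y-bézout j) (⟨⟩-combination₂ (s₁ j) (s₂ j)))
  gcdL-zs≡1 : gcdL (z₁ j ∷ z₂ j ∷ z₃ j ∷ []) ≡ 1
  gcdL-zs≡1 = gcdL≡1 (⟨⟩-combination₃ (v₁ j) (v₂ j) (v₃ j))
    (subst ⟨ _ ⟩ (z-bézout j) (⟨⟩-combination₃ (u₁ j) (u₂ j) (u₃ j)))
  gcd₂ : gcdL (a₁ j ∷ a₂ j ∷ []) ≡ d₂ j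
  gcd₂ = gcdL-coprimeCofactors ys≈ gcdL-ys≡1
  gcd₃ : gcdL (a₁ j ∷ a₂ j ∷ a₃ j ∷ []) ≡ d₃ j
  gcd₃ = gcdL-coprimeCofactors zs≈ gcdL-zs≡1
  step : ∀ ps a rest → a₁ j ∷ a₂ j ∷ a₃ j ∷ a₄ j ∷ [] ≡ ps ++ a ∷ rest → 1 ≤ length ps →
         TeleStep ps a
  step (_ ∷ [])         _ _ refl _ = teleStep-singleton (a₁ j) (a₂ j)
  step (_ ∷ _ ∷ [])     _ _ refl _ =
    teleStep {a₁ j ∷ a₂ j ∷ []} {a₃ j} gcd₂ gcd₃ ys≈ (z₃*d₃≡a₃ j)
      (subst ⟨ _ ⟩ (sym (z₃≡ j)) (⟨⟩-combination₂ (p₁ j) (p₂ j)))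
  step (_ ∷ _ ∷ _ ∷ []) _ _ refl _ =
    teleStep {a₁ j ∷ a₂ j ∷ a₃ j ∷ []} {a₄ j} gcd₃ gcd≡1 zs≈ (*-identityʳ (a₄ j))
      (subst ⟨ _ ⟩ (sym (a₄≡ j)) (⟨⟩-combination₃ (q₁ j) (q₂ j) (q₃ j)))
  step (_ ∷ _ ∷ _ ∷ _ ∷ [])    _ _ () _
  step (_ ∷ _ ∷ _ ∷ _ ∷ _ ∷ _) _ _ () _

-- Tetrahedral numbers

2*[1+m]C2 : ∀ m → 2 * (suc m C 2) ≡ m * suc m
2*[1+m]C2 zero    = refl
2*[1+m]C2 (suc m) = begin
  2 * (suc (suc m) C 2)             ≡⟨ cong (2 *_) (nCk+nC[k+1]≡[n+1]C[k+1] (suc m) 1) ⟨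
  2 * (suc m C 1 + suc m C 2)       ≡⟨ *-distribˡ-+ 2 (suc m C 1) (suc m C 2) ⟩
  2 * (suc m C 1) + 2 * (suc m C 2) ≡⟨ cong₂ (λ a b → 2 * a + b) (nC1≡n (suc m)) (2*[1+m]C2 m) ⟩
  2 * suc m + m * suc m             ≡⟨ *-distribʳ-+ (suc m) 2 m ⟨
  suc (suc m) * suc m               ≡⟨ *-comm (suc (suc m)) (suc m) ⟩
  suc m * suc (suc m)               ∎
  where open ≡-Reasoning

6*[2+m]C3 : ∀ m → 6 * (suc (suc m) C 3) ≡ m * suc m * suc (suc m)
6*[2+m]C3 zero    = refl
6*[2+m]C3 (suc m) = begin
  6 * (suc (suc (suc m)) C 3)                         ≡⟨ cong (6 *_) (nCk+nC[k+1]≡[n+1]C[k+1] (suc (suc m)) 2) ⟨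
  6 * (suc (suc m) C 2 + suc (suc m) C 3)             ≡⟨ split (suc (suc m) C 2) (suc (suc m) C 3) ⟩
  3 * (2 * (suc (suc m) C 2)) + 6 * (suc (suc m) C 3) ≡⟨ cong₂ (λ a b → 3 * a + b) (2*[1+m]C2 (suc m)) (6*[2+m]C3 m) ⟩
  3 * (suc m * suc (suc m)) + m * suc m * suc (suc m) ≡⟨ collect m ⟩
  suc m * suc (suc m) * suc (suc (suc m))             ∎
  where
  open ≡-Reasoning
  split : ∀ a b → 6 * (a + b) ≡ 3 * (2 * a) + 6 * b
  split = solve-∀
  collect : ∀ m → 3 * (suc m * suc (suc m)) + m * suc m * suc (suc m)
                ≡ suc m * suc (suc m) * suc (suc (suc m))
  collect = solve-∀

TH-formula : ∀ m → 6 * TH m ≡ m * (1 + m) * (2 + m)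
TH-formula m = subst (λ k → 6 * (k C 3) ≡ m * (1 + m) * (2 + m)) (+-comm 2 m) (6*[2+m]C3 m)

TH-<-suc : ∀ m → TH m < TH (suc m)
TH-<-suc m = *-cancelˡ-< 6 (TH m) (TH (suc m)) (begin-strict
  6 * TH m                  ≡⟨ TH-formula m ⟩
  m * (1 + m) * (2 + m)     <⟨ m<m+n _ (s≤s z≤n) ⟩
  m * (1 + m) * (2 + m) + suc (3 * m * m + 9 * m + 5)
                            ≡⟨ expand m ⟩
  suc m * (2 + m) * (3 + m) ≡⟨ TH-formula (suc m) ⟨
  6 * TH (suc m)            ∎)
  where
  open ≤-Reasoning
  expand : ∀ m → m * (1 + m) * (2 + m) + suc (3 * m * m + 9 * m + 5) ≡ suc m * (2 + m) * (3 + m)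
  expand = solve-∀

TH-< : ∀ {m n} → m < n → TH m < TH n
TH-< {m} {suc n} (s≤s m≤n) with m≤n⇒m<n∨m≡n m≤n
... | inj₁ m<n  = <-trans (TH-< m<n) (TH-<-suc n)
... | inj₂ refl = TH-<-suc m

TH-identity : ∀ n → TH (n + 3) + 3 * TH (n + 1) ≡ suc (3 * TH (n + 2) + TH n)
TH-identity n = *-cancelˡ-≡ _ _ 6 (begin
  6 * (TH (n + 3) + 3 * TH (n + 1))     ≡⟨ distrib (TH (n + 3)) (TH (n + 1)) ⟩
  6 * TH (n + 3) + 3 * (6 * TH (n + 1)) ≡⟨ cong₂ (λ a b → a + 3 * b) (TH-formula (n + 3)) (TH-formula (n + 1)) ⟩
  _                                     ≡⟨ cubic n ⟩
  _                                     ≡⟨ cong₂ (λ a b → 6 + (3 * a + b)) (TH-formula (n + 2)) (TH-formula n) ⟨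
  6 + (3 * (6 * TH (n + 2)) + 6 * TH n) ≡⟨ distrib′ (TH (n + 2)) (TH n) ⟩
  6 * suc (3 * TH (n + 2) + TH n)       ∎)
  where
  open ≡-Reasoning
  distrib : ∀ a b → 6 * (a + 3 * b) ≡ 6 * a + 3 * (6 * b)
  distrib = solve-∀
  distrib′ : ∀ a b → 6 + (3 * (6 * a) + 6 * b) ≡ 6 * suc (3 * a + b)
  distrib′ = solve-∀
  cubic : ∀ n → (n + 3) * (1 + (n + 3)) * (2 + (n + 3)) + 3 * ((n + 1) * (1 + (n + 1)) * (2 + (n + 1)))
              ≡ 6 + (3 * ((n + 2) * (1 + (n + 2)) * (2 + (n + 2))) + n * (1 + n) * (2 + n))
  cubic = solve-∀

TH-doubling : ∀ n → 11 ≤ n → TH (n + 3) < TH n + TH n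
TH-doubling n 11≤n with m≤n⇒∃[o]m+o≡n 11≤n
... | m , refl = *-cancelˡ-< 6 _ _ (begin-strict
  6 * TH (11 + m + 3)               ≡⟨ TH-formula (11 + m + 3) ⟩
  _                                 <⟨ m<m+n _ (s≤s z≤n) ⟩
  _                                 ≡⟨ cubic m ⟩
  _                                 ≡⟨ cong₂ _+_ (TH-formula (11 + m)) (TH-formula (11 + m)) ⟨
  6 * TH (11 + m) + 6 * TH (11 + m) ≡⟨ *-distribˡ-+ 6 (TH (11 + m)) (TH (11 + m)) ⟨
  6 * (TH (11 + m) + TH (11 + m))   ∎)
  where
  open ≤-Reasoning
  -- the remainder is 2 · 6 TH n − 6 TH (n + 3) − 1 at n = 11 + m; shifting by 11 makes all its
  -- coefficients non-negative
  cubic : ∀ m → (11 + m + 3) * (1 + (11 + m + 3)) * (2 + (11 + m + 3))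
                  + suc (71 + 188 * m + 27 * (m * m) + m * m * m)
              ≡ (11 + m) * (1 + (11 + m)) * (2 + (11 + m)) + (11 + m) * (1 + (11 + m)) * (2 + (11 + m))
  cubic = solve-∀

-- Stated for families so that the hypothesis is a universally quantified identity, as solve-∀ needs.
TH-by-formula : ∀ (m p : ℕ → ℕ) → (∀ j → m j * (1 + m j) * (2 + m j) ≡ 6 * p j) →
  ∀ j → TH (m j) ≡ p j
TH-by-formula m p formula j = *-cancelˡ-≡ (TH (m j)) (p j) 6 (trans (TH-formula (m j)) (formula j))

-- The semigroup 𝒯ℋ n

generators : ℕ → List ℕ
generators n = TH n ∷ TH (n + 1) ∷ TH (n + 2) ∷ TH (n + 3) ∷ []

generators-increasing : ∀ n → Linked _<_ (generators n)
generators-increasing n =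
  TH-< (m<m+n n (n<1+n 0)) ∷ TH-< (+-monoʳ-< n (n<1+n 1)) ∷ TH-< (+-monoʳ-< n (n<1+n 2)) ∷ [-]

generators-positive : ∀ {n} → 0 < n → All (0 <_) (generators n)
generators-positive {n} 0<n = Linked⇒All <-trans (TH-< 0<n) (generators-increasing n)

generators-consecutive : ∀ n → ∃ λ N → ⟨ generators n ⟩ N × ⟨ generators n ⟩ (suc N)
generators-consecutive n =
  3 * TH (n + 2) + TH n ,
  ⟨⟩-+ (⟨⟩-* 3 (⟨⟩-∈ (there (there (here refl))))) (⟨⟩-∈ (here refl)) ,
  subst ⟨ generators n ⟩ (TH-identity n)
    (⟨⟩-+ (⟨⟩-∈ (there (there (there (here refl))))) (⟨⟩-* 3 (⟨⟩-∈ (there (here refl)))))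

generators-independent-large : ∀ n → 11 ≤ n → Independent [] (generators n)
generators-independent-large n 11≤n
  with Linked⇒AllPairs <-trans (generators-increasing n)
     | generators-positive {n} (≤-trans (s≤s z≤n) 11≤n)
... | (a<b ∷ a<c ∷ a<d ∷ []) ∷ (b<c ∷ b<d ∷ []) ∷ (c<d ∷ []) ∷ _ | 0<a ∷ 0<b ∷ 0<c ∷ 0<d ∷ [] =
  ⟨⟩-gap {TH n} [] [] 0<a (belowDouble (<⇒≤ a<d)) ,
  ⟨⟩-gap (≤-refl ∷ []) (a<b ∷ []) 0<b (belowDouble (<⇒≤ b<d)) ,
  ⟨⟩-gap (≤-refl ∷ <⇒≤ a<b ∷ []) (a<c ∷ b<c ∷ []) 0<c (belowDouble (<⇒≤ c<d)) ,
  ⟨⟩-gap (≤-refl ∷ <⇒≤ a<b ∷ <⇒≤ a<c ∷ []) (a<d ∷ b<d ∷ c<d ∷ []) 0<d (belowDouble ≤-refl) ,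
  tt
  where
  belowDouble : ∀ {g} → g ≤ TH (n + 3) → g < TH n + TH n
  belowDouble g≤ = ≤-<-trans g≤ (TH-doubling n 11≤n)

generators-independent-small : ∀ n → 4 ≤ n → n < 11 → Independent [] (generators n)
generators-independent-small n 4≤n n<11 =
  from-yes (allUpTo? (λ m → 4 ≤? m →-dec independent? [] (generators m)) 11) n<11 4≤n

generators-independent : ∀ n → 4 ≤ n → Independent [] (generators n)
generators-independent n 4≤n with n <? 11
... | yes n<11 = generators-independent-small n 4≤n n<11
... | no  n≮11 = generators-independent-large n (≮⇒≥ n≮11)

𝒯ℋ-numerical : ∀ n → IsNumericalSemigroup (𝒯ℋ n)
𝒯ℋ-numerical n =
  let (N , N∈ , N+1∈) = generators-consecutive n in
  ⟨⟩-0 (generators n) , (λ _ _ → ⟨⟩-+) , N * N , ⟨⟩-cofinite N∈ N+1∈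

𝒯ℋ-embeddingDimension : ∀ n → 4 ≤ n → EmbeddingDimension (𝒯ℋ n) 4
𝒯ℋ-embeddingDimension n 4≤n =
  generators n ,
  minimal-generators (generators-positive (≤-trans (s≤s z≤n) 4≤n)) (AllPairs.map <⇒≢ increasing)
    (independent⇒indecomposable [] increasing (generators-independent n 4≤n)) ,
  refl
  where increasing = Linked⇒AllPairs <-trans (generators-increasing n)

𝒯ℋ-free-increasing : ∀ (n : ℕ → ℕ) {a₁ a₂ a₃ a₄ : ℕ → ℕ} j → 0 < n j →
  (∀ j → TH (n j) ≡ a₁ j) → (∀ j → TH (n j + 1) ≡ a₂ j) →
  (∀ j → TH (n j + 2) ≡ a₃ j) → (∀ j → TH (n j + 3) ≡ a₄ j) →
  Telescopic₄Certificate a₁ a₂ a₃ a₄ → IsFree (𝒯ℋ (n j))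
𝒯ℋ-free-increasing n j 0<n a₁≡ a₂≡ a₃≡ a₄≡ certificate =
  let (_ , N∈ , N+1∈) = generators-consecutive (n j) in
  generators (n j) ,
  telescopic₄ certificate j (Pointwise-≡⇒≡ (a₁≡ j ∷ a₂≡ j ∷ a₃≡ j ∷ a₄≡ j ∷ []))
    (generators-positive 0<n) (gcdL≡1 N∈ N+1∈) ,
  λ _ → mk⇔ id id

𝒯ℋ-free-decreasing : ∀ (n : ℕ → ℕ) {a₁ a₂ a₃ a₄ : ℕ → ℕ} j → 0 < n j →
  (∀ j → TH (n j + 3) ≡ a₁ j) → (∀ j → TH (n j + 2) ≡ a₂ j) →
  (∀ j → TH (n j + 1) ≡ a₃ j) → (∀ j → TH (n j) ≡ a₄ j) →
  Telescopic₄Certificate a₁ a₂ a₃ a₄ → IsFree (𝒯ℋ (n j))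
𝒯ℋ-free-decreasing n j 0<n a₁≡ a₂≡ a₃≡ a₄≡ certificate =
  let (_ , N∈ , N+1∈) = generators-consecutive (n j) in
  reverse (generators (n j)) ,
  telescopic₄ certificate j (Pointwise-≡⇒≡ (a₁≡ j ∷ a₂≡ j ∷ a₃≡ j ∷ a₄≡ j ∷ []))
    (tabulate (lookup (generators-positive 0<n) ∘ Any.reverse⁻))
    (gcdL≡1 (⟨⟩-reverse⁺ N∈) (⟨⟩-reverse⁺ N+1∈)) ,
  λ _ → mk⇔ ⟨⟩-reverse⁺ ⟨⟩-reverse⁻

𝒯ℋ-free-4+6j : ∀ j → IsFree (𝒯ℋ (4 + 6 * j))
𝒯ℋ-free-4+6j j = 𝒯ℋ-free-decreasing (λ j → 4 + 6 * j) j (s≤s z≤n)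
  (TH-by-formula (λ j → 4 + 6 * j + 3) (λ j → (6 * j + 7) * (3 * j + 4) * (2 * j + 3)) solve-∀)
  (TH-by-formula (λ j → 4 + 6 * j + 2) (λ j → 2 * (j + 1) * (6 * j + 7) * (3 * j + 4)) solve-∀)
  (TH-by-formula (λ j → 4 + 6 * j + 1) (λ j → (6 * j + 5) * (j + 1) * (6 * j + 7)) solve-∀)
  (TH-by-formula (λ j → 4 + 6 * j) (λ j → 2 * (3 * j + 2) * (6 * j + 5) * (j + 1)) solve-∀)
  record
    { d₂ = λ j → (6 * j + 7) * (3 * j + 4)
    ; y₁ = λ j → 2 * j + 3 ; y₂ = λ j → 2 * (j + 1)
    ; y₁*d₂≡a₁ = solve-∀ ; y₂*d₂≡a₂ = solve-∀
    ; s₁ = λ _ → 1 ; s₂ = λ _ → 0 ; t₁ = λ _ → 0 ; t₂ = λ _ → 1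
    ; y-bézout = solve-∀
    ; d₃ = λ j → 6 * j + 7
    ; z₁ = λ j → (3 * j + 4) * (2 * j + 3) ; z₂ = λ j → 2 * (j + 1) * (3 * j + 4)
    ; z₃ = λ j → (6 * j + 5) * (j + 1)
    ; z₁*d₃≡a₁ = solve-∀ ; z₂*d₃≡a₂ = solve-∀ ; z₃*d₃≡a₃ = solve-∀
    ; u₁ = λ _ → 1 ; u₂ = λ _ → 0 ; u₃ = λ _ → 1
    ; v₁ = λ _ → 0 ; v₂ = λ _ → 2 ; v₃ = λ _ → 0
    ; z-bézout = solve-∀
    ; p₁ = λ j → j + 1 ; p₂ = λ j → 2 * j + 1 ; z₃≡ = solve-∀
    ; q₁ = λ _ → 0 ; q₂ = λ _ → 0 ; q₃ = λ j → 2 * (3 * j + 2) ; a₄≡ = solve-∀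
    }

𝒯ℋ-free-5+6j : ∀ j → IsFree (𝒯ℋ (5 + 6 * j))
𝒯ℋ-free-5+6j j = 𝒯ℋ-free-decreasing (λ j → 5 + 6 * j) j (s≤s z≤n)
  (TH-by-formula (λ j → 5 + 6 * j + 3) (λ j → 2 * (3 * j + 4) * (2 * j + 3) * (3 * j + 5)) solve-∀)
  (TH-by-formula (λ j → 5 + 6 * j + 2) (λ j → (6 * j + 7) * (3 * j + 4) * (2 * j + 3)) solve-∀)
  (TH-by-formula (λ j → 5 + 6 * j + 1) (λ j → 2 * (j + 1) * (6 * j + 7) * (3 * j + 4)) solve-∀)
  (TH-by-formula (λ j → 5 + 6 * j) (λ j → (6 * j + 5) * (j + 1) * (6 * j + 7)) solve-∀)
  record
    { d₂ = λ j → (3 * j + 4) * (2 * j + 3)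
    ; y₁ = λ j → 2 * (3 * j + 5) ; y₂ = λ j → 6 * j + 7
    ; y₁*d₂≡a₁ = solve-∀ ; y₂*d₂≡a₂ = solve-∀
    ; s₁ = λ _ → 0 ; s₂ = λ j → 2 * j + 3 ; t₁ = λ j → 2 * j + 2 ; t₂ = λ _ → 0
    ; y-bézout = solve-∀
    ; d₃ = λ j → 3 * j + 4
    ; z₁ = λ j → 2 * (2 * j + 3) * (3 * j + 5) ; z₂ = λ j → (6 * j + 7) * (2 * j + 3)
    ; z₃ = λ j → 2 * (j + 1) * (6 * j + 7)
    ; z₁*d₃≡a₁ = solve-∀ ; z₂*d₃≡a₂ = solve-∀ ; z₃*d₃≡a₃ = solve-∀
    ; u₁ = λ _ → 0 ; u₂ = λ j → 2 * j + 3 ; u₃ = λ j → j + 2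
    ; v₁ = λ j → 3 * j + 3 ; v₂ = λ _ → 0 ; v₃ = λ _ → 0
    ; z-bézout = solve-∀
    ; p₁ = λ _ → 0 ; p₂ = λ j → 2 * (j + 1) ; z₃≡ = solve-∀
    ; q₁ = λ _ → 0 ; q₂ = λ j → j + 1 ; q₃ = λ j → 2 * j + 1 ; a₄≡ = solve-∀
    }

𝒯ℋ-free-6+6j : ∀ j → IsFree (𝒯ℋ (6 + 6 * j))
𝒯ℋ-free-6+6j j = 𝒯ℋ-free-increasing (λ j → 6 + 6 * j) j (s≤s z≤n)
  (TH-by-formula (λ j → 6 + 6 * j) (λ j → 2 * (j + 1) * (6 * j + 7) * (3 * j + 4)) solve-∀)
  (TH-by-formula (λ j → 6 + 6 * j + 1) (λ j → (6 * j + 7) * (3 * j + 4) * (2 * j + 3)) solve-∀)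
  (TH-by-formula (λ j → 6 + 6 * j + 2) (λ j → 2 * (3 * j + 4) * (2 * j + 3) * (3 * j + 5)) solve-∀)
  (TH-by-formula (λ j → 6 + 6 * j + 3) (λ j → (2 * j + 3) * (3 * j + 5) * (6 * j + 11)) solve-∀)
  record
    { d₂ = λ j → (6 * j + 7) * (3 * j + 4)
    ; y₁ = λ j → 2 * (j + 1) ; y₂ = λ j → 2 * j + 3
    ; y₁*d₂≡a₁ = solve-∀ ; y₂*d₂≡a₂ = solve-∀
    ; s₁ = λ _ → 0 ; s₂ = λ _ → 1 ; t₁ = λ _ → 1 ; t₂ = λ _ → 0
    ; y-bézout = solve-∀
    ; d₃ = λ j → 3 * j + 4
    ; z₁ = λ j → 2 * (j + 1) * (6 * j + 7) ; z₂ = λ j → (6 * j + 7) * (2 * j + 3)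
    ; z₃ = λ j → 2 * (2 * j + 3) * (3 * j + 5)
    ; z₁*d₃≡a₁ = solve-∀ ; z₂*d₃≡a₂ = solve-∀ ; z₃*d₃≡a₃ = solve-∀
    ; u₁ = λ j → j + 2 ; u₂ = λ j → 2 * j + 3 ; u₃ = λ _ → 0
    ; v₁ = λ _ → 0 ; v₂ = λ _ → 0 ; v₃ = λ j → 3 * j + 3
    ; z-bézout = solve-∀
    ; p₁ = λ _ → 0 ; p₂ = λ j → 2 * (3 * j + 5) ; z₃≡ = solve-∀
    ; q₁ = λ _ → 0 ; q₂ = λ j → 3 * j + 5 ; q₃ = λ _ → 2 ; a₄≡ = solve-∀
    }

𝒯ℋ-free-7+6j : ∀ j → IsFree (𝒯ℋ (7 + 6 * j))
𝒯ℋ-free-7+6j j = 𝒯ℋ-free-increasing (λ j → 7 + 6 * j) j (s≤s z≤n)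
  (TH-by-formula (λ j → 7 + 6 * j) (λ j → (6 * j + 7) * (3 * j + 4) * (2 * j + 3)) solve-∀)
  (TH-by-formula (λ j → 7 + 6 * j + 1) (λ j → 2 * (3 * j + 4) * (2 * j + 3) * (3 * j + 5)) solve-∀)
  (TH-by-formula (λ j → 7 + 6 * j + 2) (λ j → (2 * j + 3) * (3 * j + 5) * (6 * j + 11)) solve-∀)
  (TH-by-formula (λ j → 7 + 6 * j + 3) (λ j → 2 * (3 * j + 5) * (6 * j + 11) * (j + 2)) solve-∀)
  record
    { d₂ = λ j → (3 * j + 4) * (2 * j + 3)
    ; y₁ = λ j → 6 * j + 7 ; y₂ = λ j → 2 * (3 * j + 5)
    ; y₁*d₂≡a₁ = solve-∀ ; y₂*d₂≡a₂ = solve-∀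
    ; s₁ = λ j → 2 * j + 3 ; s₂ = λ _ → 0 ; t₁ = λ _ → 0 ; t₂ = λ j → 2 * j + 2
    ; y-bézout = solve-∀
    ; d₃ = λ j → 2 * j + 3
    ; z₁ = λ j → (6 * j + 7) * (3 * j + 4) ; z₂ = λ j → 2 * (3 * j + 4) * (3 * j + 5)
    ; z₃ = λ j → (3 * j + 5) * (6 * j + 11)
    ; z₁*d₃≡a₁ = solve-∀ ; z₂*d₃≡a₂ = solve-∀ ; z₃*d₃≡a₃ = solve-∀
    ; u₁ = λ j → j + 2 ; u₂ = λ _ → 0 ; u₃ = λ _ → 0
    ; v₁ = λ _ → 0 ; v₂ = λ _ → 0 ; v₃ = λ j → j + 1
    ; z-bézout = solve-∀
    ; p₁ = λ j → 3 * j + 5 ; p₂ = λ _ → 2 ; z₃≡ = solve-∀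
    ; q₁ = λ _ → 0 ; q₂ = λ _ → 0 ; q₃ = λ j → 2 * (j + 2) ; a₄≡ = solve-∀
    }

𝒯ℋ-free-8+6j : ∀ j → IsFree (𝒯ℋ (8 + 6 * j))
𝒯ℋ-free-8+6j j = 𝒯ℋ-free-increasing (λ j → 8 + 6 * j) j (s≤s z≤n)
  (TH-by-formula (λ j → 8 + 6 * j) (λ j → 2 * (3 * j + 4) * (2 * j + 3) * (3 * j + 5)) solve-∀)
  (TH-by-formula (λ j → 8 + 6 * j + 1) (λ j → (2 * j + 3) * (3 * j + 5) * (6 * j + 11)) solve-∀)
  (TH-by-formula (λ j → 8 + 6 * j + 2) (λ j → 2 * (3 * j + 5) * (6 * j + 11) * (j + 2)) solve-∀)
  (TH-by-formula (λ j → 8 + 6 * j + 3) (λ j → (6 * j + 11) * (j + 2) * (6 * j + 13)) solve-∀)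
  record
    { d₂ = λ j → (2 * j + 3) * (3 * j + 5)
    ; y₁ = λ j → 2 * (3 * j + 4) ; y₂ = λ j → 6 * j + 11
    ; y₁*d₂≡a₁ = solve-∀ ; y₂*d₂≡a₂ = solve-∀
    ; s₁ = λ _ → 0 ; s₂ = λ j → 2 * j + 3 ; t₁ = λ j → 2 * j + 4 ; t₂ = λ _ → 0
    ; y-bézout = solve-∀
    ; d₃ = λ j → 3 * j + 5
    ; z₁ = λ j → 2 * (3 * j + 4) * (2 * j + 3) ; z₂ = λ j → (2 * j + 3) * (6 * j + 11)
    ; z₃ = λ j → 2 * (6 * j + 11) * (j + 2)
    ; z₁*d₃≡a₁ = solve-∀ ; z₂*d₃≡a₂ = solve-∀ ; z₃*d₃≡a₃ = solve-∀
    ; u₁ = λ _ → 0 ; u₂ = λ j → 2 * j + 1 ; u₃ = λ j → j + 2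
    ; v₁ = λ j → 3 * j + 5 ; v₂ = λ _ → 0 ; v₃ = λ _ → 0
    ; z-bézout = solve-∀
    ; p₁ = λ _ → 0 ; p₂ = λ j → 2 * (j + 2) ; z₃≡ = solve-∀
    ; q₁ = λ _ → 0 ; q₂ = λ j → j + 2 ; q₃ = λ j → 2 * j + 5 ; a₄≡ = solve-∀
    }

𝒯ℋ-free-9+6j : ∀ j → IsFree (𝒯ℋ (9 + 6 * j))
𝒯ℋ-free-9+6j j = 𝒯ℋ-free-increasing (λ j → 9 + 6 * j) j (s≤s z≤n)
  (TH-by-formula (λ j → 9 + 6 * j) (λ j → (2 * j + 3) * (3 * j + 5) * (6 * j + 11)) solve-∀)
  (TH-by-formula (λ j → 9 + 6 * j + 1) (λ j → 2 * (3 * j + 5) * (6 * j + 11) * (j + 2)) solve-∀)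
  (TH-by-formula (λ j → 9 + 6 * j + 2) (λ j → (6 * j + 11) * (j + 2) * (6 * j + 13)) solve-∀)
  (TH-by-formula (λ j → 9 + 6 * j + 3) (λ j → 2 * (j + 2) * (6 * j + 13) * (3 * j + 7)) solve-∀)
  record
    { d₂ = λ j → (3 * j + 5) * (6 * j + 11)
    ; y₁ = λ j → 2 * j + 3 ; y₂ = λ j → 2 * (j + 2)
    ; y₁*d₂≡a₁ = solve-∀ ; y₂*d₂≡a₂ = solve-∀
    ; s₁ = λ _ → 0 ; s₂ = λ _ → 1 ; t₁ = λ _ → 1 ; t₂ = λ _ → 0
    ; y-bézout = solve-∀
    ; d₃ = λ j → 6 * j + 11
    ; z₁ = λ j → (2 * j + 3) * (3 * j + 5) ; z₂ = λ j → 2 * (3 * j + 5) * (j + 2)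
    ; z₃ = λ j → (j + 2) * (6 * j + 13)
    ; z₁*d₃≡a₁ = solve-∀ ; z₂*d₃≡a₂ = solve-∀ ; z₃*d₃≡a₃ = solve-∀
    ; u₁ = λ _ → 1 ; u₂ = λ _ → 0 ; u₃ = λ _ → 1
    ; v₁ = λ _ → 0 ; v₂ = λ _ → 2 ; v₃ = λ _ → 0
    ; z-bézout = solve-∀
    ; p₁ = λ j → j + 2 ; p₂ = λ j → 2 * j + 5 ; z₃≡ = solve-∀
    ; q₁ = λ _ → 0 ; q₂ = λ _ → 0 ; q₃ = λ j → 2 * (3 * j + 7) ; a₄≡ = solve-∀
    }

𝒯ℋ-free-residue : ∀ r j → r < 6 → IsFree (𝒯ℋ (4 + r + 6 * j))
𝒯ℋ-free-residue 0 j _ = 𝒯ℋ-free-4+6j j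
𝒯ℋ-free-residue 1 j _ = 𝒯ℋ-free-5+6j j
𝒯ℋ-free-residue 2 j _ = 𝒯ℋ-free-6+6j j
𝒯ℋ-free-residue 3 j _ = 𝒯ℋ-free-7+6j j
𝒯ℋ-free-residue 4 j _ = 𝒯ℋ-free-8+6j j
𝒯ℋ-free-residue 5 j _ = 𝒯ℋ-free-9+6j j
𝒯ℋ-free-residue (suc (suc (suc (suc (suc (suc _)))))) _ (s≤s (s≤s (s≤s (s≤s (s≤s (s≤s ()))))))

𝒯ℋ-free : ∀ n → 4 ≤ n → IsFree (𝒯ℋ n)
𝒯ℋ-free n 4≤n with m≤n⇒∃[o]m+o≡n 4≤n
... | m , refl = subst (IsFree ∘ 𝒯ℋ ∘ (4 +_)) m≡ (𝒯ℋ-free-residue (m % 6) (m / 6) (m%n<n m 6))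
  where
  m≡ : m % 6 + 6 * (m / 6) ≡ m
  m≡ = trans (cong (m % 6 +_) (*-comm 6 (m / 6))) (sym (m≡m%n+[m/n]*n m 6))

proposition32 : (n : ℕ) → 4 ≤ n →
    IsFreeNumericalSemigroup (𝒯ℋ n) × EmbeddingDimension (𝒯ℋ n) 4
proposition32 n 4≤n = (𝒯ℋ-numerical n , 𝒯ℋ-free n 4≤n) , 𝒯ℋ-embeddingDimension n 4≤n
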